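{- Write $a_n(x)=\sum_{k=0}^n b(n,k)(x-1)^k$, and set $b(x,y)=0$ whenever $y>x$, $x<0$ or $y<0$. Then $b(0,0)=1$ and for all integers $n\ge1$ and $k\neq-1$, $$b(n,k)=b(n,k+1)+b(n-1,k-1).$$
   Context: For $n\ge0$, $a_n(x)=\sum_{\pi\in S_n(321)}x^{f(\pi)}$, where $S_n(321)$ is the set of permutations $\pi=\pi_1\cdots\pi_n$ of $\{1,\dots,n\}$ with no indices $i<j<l$ such that $\pi_i>\pi_j>\pi_l$, and $f(\pi)$ is the number of indices $i$ with $\pi_i=i$ ($a_0(x)=1$). -}

module Defs where

open import Data.Nat as ℕ using (ℕ; zero; suc; _<ᵇ_; _≡ᵇ_)
open import Data.Bool using (Bool; true; false; _∧_; _∨_; if_then_else_)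
open import Data.Bool.ListAction using (any)
open import Data.List using (List; []; _∷_; map; concatMap; filter; foldr; upTo; replicate; _++_)
open import Data.Integer as ℤ using (ℤ; +_; -[1+_])
open import Relation.Nullary.Decidable using (Dec)
open import Relation.Binary.PropositionalEquality using (_≡_)
open import Data.Bool.Properties using (_≟_)

-- Permutations of {1,…,n}, written in one-line notation π₁⋯πₙ as lists.

insertions : ℕ → List ℕ → List (List ℕ)
insertions x []       = (x ∷ []) ∷ []
insertions x (y ∷ ys) = (x ∷ y ∷ ys) ∷ map (y ∷_) (insertions x ys)

perms : List ℕ → List (List ℕ)
perms []       = [] ∷ []
perms (x ∷ xs) = concatMap (insertions x) (perms xs)

S : ℕ → List (List ℕ)
S n = perms (map suc (upTo n))

-- 321 patterns: indices i<j<l with π_i > π_j > π_l.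

decPair : ℕ → List ℕ → Bool
decPair a []      = false
decPair a (b ∷ r) = ((b <ᵇ a) ∧ any (λ c → c <ᵇ b) r) ∨ decPair a r

contains321 : List ℕ → Bool
contains321 []      = false
contains321 (a ∷ r) = decPair a r ∨ contains321 r

avoids321 : List ℕ → Bool
avoids321 π = if contains321 π then false else true

S321 : ℕ → List (List ℕ)
S321 n = filter (λ π → avoids321 π ≟ true) (S n)

-- f(π) = number of fixed points, π_i = i (positions counted from 1)
fixFrom : ℕ → List ℕ → ℕ
fixFrom i []      = 0
fixFrom i (a ∷ r) = (if a ≡ᵇ i then 1 else 0) ℕ.+ fixFrom (suc i) r

fp : List ℕ → ℕ
fp π = fixFrom 1 π

-- Polynomials over ℤ as coefficient lists (lowest degree first).

Poly : Set
Poly = List ℤ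

infixl 6 _⊕_
infixl 7 _⊗_

_⊕_ : Poly → Poly → Poly
[]      ⊕ q       = q
(a ∷ p) ⊕ []      = a ∷ p
(a ∷ p) ⊕ (b ∷ q) = (a ℤ.+ b) ∷ (p ⊕ q)

scale : ℤ → Poly → Poly
scale c p = map (c ℤ.*_) p

_⊗_ : Poly → Poly → Poly
[]      ⊗ q = []
(a ∷ p) ⊗ q = scale a q ⊕ (+ 0 ∷ (p ⊗ q))

pow : Poly → ℕ → Poly
pow p zero    = + 1 ∷ []
pow p (suc k) = p ⊗ pow p k

monomial : ℕ → Poly
monomial j = replicate j (+ 0) ++ (+ 1 ∷ [])

xMinus1 : Poly
xMinus1 = -[1+ 0 ] ∷ + 1 ∷ []

coeff : Poly → ℕ → ℤ
coeff []      j       = + 0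
coeff (a ∷ p) zero    = a
coeff (a ∷ p) (suc j) = coeff p j

a : ℕ → Poly
a n = foldr (λ π acc → monomial (fp π) ⊕ acc) [] (S321 n)

sumShifted : ℕ → (ℕ → ℤ) → Poly
sumShifted n c = foldr (λ k acc → scale (c k) (pow xMinus1 k) ⊕ acc) [] (upTo (suc n))

-- Since x ^ f = ((x - 1) + 1) ^ f, a_n(x) = Σ_k b(n,k) (x - 1)^k with b(n,k) = Σ_{π ∈ S_n(321)} C(f(π), k),
-- and these coefficients are unique because the coefficient matrix of the powers (x - 1)^k is unitriangular.
-- For the recurrence, every π ∈ S_{n+1}(321) arises exactly once by inserting 1 into σ + 1, σ ∈ S_n(321),
-- either in front or inside the initial ascending run of σ. Let m be the number of leading fixed points
-- 1, …, m of σ, r the number of its other fixed points and L the length of its initial ascending run;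
-- these determine the same statistics of every child. Split C(r + m, k) into weights φ(e, k), e ≥ 0, whose
-- tails are ψ(e, k) = Σ_{e' ≥ e} φ(e', k) = [e ≤ L] C(r + m - e, k), and sum them over S_n(321) to Tφ(n, e, k)
-- and Tψ(n, e, k). Insertion of 1 gives Tφ(n+1, 0, k) = Tψ(n, 0, k-1) = b(n, k-1) and
-- Tφ(n+1, e+1, k) = Tφ(n, e, k) + Tψ(n, e+1, k), from which induction on n yields the shift invariance
-- Tφ(n, e+1, k) = Tφ(n, e, k+1), hence Tψ(n, 1, k) = Tψ(n, 0, k+1). Therefore
-- b(n+1, k) = Tφ(n+1, 0, k) + Tψ(n+1, 1, k) = b(n, k-1) + b(n+1, k+1).

module Submission where

open import Defs

module Counting where

  open import Algebra.Bundles using (CommutativeMonoid)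
  open import Data.Bool using (Bool; true; false; not; _∧_; _∨_; T; if_then_else_)
  open import Data.Bool.Properties using (T-≡; ∨-identityʳ; ∨-zeroʳ; ∨-commutativeMonoid; _≟_)
  open import Data.Bool.ListAction using (any)
  open import Data.Empty using (⊥-elim)
  open import Data.List using (List; []; _∷_; map; concat; concatMap; filter; upTo; _++_; length; take; drop)
  open import Data.List.Properties
    using (map-∘; map-cong; concat-map; map-upTo; length-map; length-upTo; length-take; take-map; drop-map; take++drop≡id; map-++)
  open import Data.List.Relation.Unary.All as All using (All; []; _∷_)
  open import Data.List.Relation.Unary.All.Properties using (map⁺; concat⁺; take⁺; drop⁺; filter⁺)
  open import Data.List.Relation.Unary.AllPairs using (_∷_)
  open import Data.List.Relation.Unary.Unique.Propositional using (Unique)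
  import Data.List.Relation.Unary.Unique.Propositional.Properties as Unique
  open import Data.List.Relation.Binary.Permutation.Propositional as ↭ using (_↭_; prep; swap; ↭-sym; ↭⇒↭ₛ)
  open import Data.List.Relation.Binary.Permutation.Propositional.Properties using (All-resp-↭; ↭-length)
  open import Data.List.Relation.Binary.Permutation.Setoid.Properties using (Unique-resp-↭)
  open import Data.Nat using (ℕ; zero; suc; _+_; _∸_; _≤_; _<_; z≤n; s≤s; z<s; _<ᵇ_; _≡ᵇ_; _≤ᵇ_; _⊓_)
  open import Data.Nat.Combinatorics using (_C_; nCk+nC[k+1]≡[n+1]C[k+1]; k>n⇒nCk≡0)
  open import Data.Nat.Properties hiding (_≟_)
  open import Data.Product using (_×_; _,_)
  open import Data.Unit using (⊤; tt)
  open import Function using (_∘_; Equivalence)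
  open import Relation.Binary.Definitions using (tri<; tri≈; tri>)
  open import Relation.Binary.PropositionalEquality
    using (_≡_; _≢_; refl; sym; trans; cong; cong₂; subst; setoid; module ≡-Reasoning)
  open import Relation.Nullary using (¬_)
  open import Algebra.Properties.CommutativeSemigroup +-commutativeSemigroup
    using () renaming (interchange to +-interchange)
  open import Algebra.Properties.CommutativeSemigroup (CommutativeMonoid.commutativeSemigroup ∨-commutativeMonoid)
    using () renaming (interchange to ∨-interchange)

  ∑ : {A : Set} → (A → ℕ) → List A → ℕ
  ∑ f []       = 0
  ∑ f (x ∷ xs) = f x + ∑ f xs

  ∑-++ : {A : Set} (f : A → ℕ) (xs ys : List A) → ∑ f (xs ++ ys) ≡ ∑ f xs + ∑ f ys
  ∑-++ f []       ys = refl
  ∑-++ f (x ∷ xs) ys = trans (cong (f x +_) (∑-++ f xs ys)) (sym (+-assoc (f x) _ _))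

  ∑-concat : {A : Set} (f : A → ℕ) (xss : List (List A)) → ∑ f (concat xss) ≡ ∑ (∑ f) xss
  ∑-concat f []         = refl
  ∑-concat f (xs ∷ xss) = trans (∑-++ f xs (concat xss)) (cong (∑ f xs +_) (∑-concat f xss))

  ∑-map : {A B : Set} (f : B → ℕ) (g : A → B) (xs : List A) → ∑ f (map g xs) ≡ ∑ (f ∘ g) xs
  ∑-map f g []       = refl
  ∑-map f g (x ∷ xs) = cong (f (g x) +_) (∑-map f g xs)

  ∑-cong : {A : Set} {f g : A → ℕ} {xs : List A} → All (λ x → f x ≡ g x) xs → ∑ f xs ≡ ∑ g xs
  ∑-cong []       = refl
  ∑-cong (p ∷ ps) = cong₂ _+_ p (∑-cong ps)

  ∑-zero : {A : Set} {f : A → ℕ} {xs : List A} → All (λ x → f x ≡ 0) xs → ∑ f xs ≡ 0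
  ∑-zero []       = refl
  ∑-zero (p ∷ ps) = cong₂ _+_ p (∑-zero ps)

  ∑-+ : {A : Set} (f g : A → ℕ) (xs : List A) → ∑ (λ x → f x + g x) xs ≡ ∑ f xs + ∑ g xs
  ∑-+ f g []       = refl
  ∑-+ f g (x ∷ xs) = trans (cong (f x + g x +_) (∑-+ f g xs)) (+-interchange (f x) (g x) _ _)

  ind : Bool → ℕ → ℕ
  ind true  x = x
  ind false x = 0

  ind-+ : ∀ b x y → ind b (x + y) ≡ ind b x + ind b y
  ind-+ true  x y = refl
  ind-+ false x y = refl

  ind-0 : ∀ b → ind b 0 ≡ 0
  ind-0 true  = refl
  ind-0 false = refl

  ∑-filter : {A : Set} (p : A → Bool) (f : A → ℕ) (xs : List A) →
    ∑ f (filter (λ x → p x ≟ true) xs) ≡ ∑ (λ x → ind (p x) (f x)) xs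
  ∑-filter p f []       = refl
  ∑-filter p f (x ∷ xs) with p x
  ... | true  = cong (f x +_) (∑-filter p f xs)
  ... | false = ∑-filter p f xs

  ∑< : ℕ → (ℕ → ℕ) → ℕ
  ∑< zero    f = 0
  ∑< (suc n) f = f 0 + ∑< n (f ∘ suc)

  ∑<-cong : ∀ n {f g : ℕ → ℕ} → (∀ p → f p ≡ g p) → ∑< n f ≡ ∑< n g
  ∑<-cong zero    f≗g = refl
  ∑<-cong (suc n) f≗g = cong₂ _+_ (f≗g 0) (∑<-cong n (f≗g ∘ suc))

  ∑<-zero : ∀ n f → (∀ p → p < n → f p ≡ 0) → ∑< n f ≡ 0
  ∑<-zero zero    f h = refl
  ∑<-zero (suc n) f h = cong₂ _+_ (h 0 z<s) (∑<-zero n (f ∘ suc) (λ p p<n → h (suc p) (s≤s p<n)))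

  ∑<-restrict : ∀ L n f g → L ≤ n → (∀ q → q < L → f q ≡ g q) → (∀ q → L ≤ q → q < n → f q ≡ 0) →
    ∑< n f ≡ ∑< L g
  ∑<-restrict zero    n       f g _         _   f≡0 = ∑<-zero n f (λ q → f≡0 q z≤n)
  ∑<-restrict (suc L) (suc n) f g (s≤s L≤n) f≡g f≡0 = cong₂ _+_ (f≡g 0 z<s)
    (∑<-restrict L n (f ∘ suc) (g ∘ suc) L≤n (λ q → f≡g (suc q) ∘ s≤s) (λ q L≤q → f≡0 (suc q) (s≤s L≤q) ∘ s≤s))

  pick : ℕ → ℕ → (ℕ → ℕ) → ℕ
  pick L zero    g = 0
  pick L (suc e) g = ind (e <ᵇ L) (g e)

  ∑<-pick : ∀ L e g → ∑< L (λ q → ind (e ≡ᵇ suc q) (g q)) ≡ pick L e g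
  ∑<-pick zero    zero          g = refl
  ∑<-pick zero    (suc e)       g = refl
  ∑<-pick (suc L) zero          g = ∑<-pick L zero (g ∘ suc)
  ∑<-pick (suc L) (suc zero)    g = trans (cong (g 0 +_) (∑<-pick L zero (g ∘ suc))) (+-identityʳ (g 0))
  ∑<-pick (suc L) (suc (suc e)) g = ∑<-pick L (suc e) (g ∘ suc)

  insertions-map : ∀ (f : ℕ → ℕ) x ys → insertions (f x) (map f ys) ≡ map (map f) (insertions x ys)
  insertions-map f x []       = refl
  insertions-map f x (y ∷ ys) = cong ((f x ∷ f y ∷ map f ys) ∷_)
    (trans (cong (map (f y ∷_)) (insertions-map f x ys))
           (trans (sym (map-∘ (insertions x ys))) (map-∘ (insertions x ys))))

  perms-map : ∀ (f : ℕ → ℕ) xs → perms (map f xs) ≡ map (map f) (perms xs)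
  perms-map f []       = refl
  perms-map f (x ∷ xs) = begin
    concatMap (insertions (f x)) (perms (map f xs))          ≡⟨ cong (concatMap (insertions (f x))) (perms-map f xs) ⟩
    concat (map (insertions (f x)) (map (map f) (perms xs))) ≡⟨ cong concat (sym (map-∘ (perms xs))) ⟩
    concat (map (insertions (f x) ∘ map f) (perms xs))       ≡⟨ cong concat (map-cong (insertions-map f x) (perms xs)) ⟩
    concat (map (map (map f) ∘ insertions x) (perms xs))     ≡⟨ cong concat (map-∘ (perms xs)) ⟩
    concat (map (map (map f)) (map (insertions x) (perms xs))) ≡⟨ concat-map (map (insertions x) (perms xs)) ⟩
    map (map f) (concatMap (insertions x) (perms xs))        ∎
    where open ≡-Reasoning

  S-suc : ∀ n → S (suc n) ≡ concatMap (insertions 1) (map (map suc) (S n))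
  S-suc n = begin
    perms (map suc (upTo (suc n)))                          ≡⟨ cong (perms ∘ map suc ∘ (0 ∷_)) (map-upTo suc n) ⟨
    concatMap (insertions 1) (perms (map suc (map suc (upTo n)))) ≡⟨ cong (concatMap (insertions 1)) (perms-map suc (map suc (upTo n))) ⟩
    concatMap (insertions 1) (map (map suc) (S n))          ∎
    where open ≡-Reasoning

  ∑-S-suc : ∀ n (h : List ℕ → ℕ) → ∑ h (S (suc n)) ≡ ∑ (λ σ → ∑ h (insertions 1 (map suc σ))) (S n)
  ∑-S-suc n h = begin
    ∑ h (S (suc n))                                               ≡⟨ cong (∑ h) (S-suc n) ⟩
    ∑ h (concat (map (insertions 1) (map (map suc) (S n))))       ≡⟨ ∑-concat h (map (insertions 1) (map (map suc) (S n))) ⟩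
    ∑ (∑ h) (map (insertions 1) (map (map suc) (S n)))            ≡⟨ ∑-map (∑ h) (insertions 1) (map (map suc) (S n)) ⟩
    ∑ (∑ h ∘ insertions 1) (map (map suc) (S n))                  ≡⟨ ∑-map (∑ h ∘ insertions 1) (map suc) (S n) ⟩
    ∑ (λ σ → ∑ h (insertions 1 (map suc σ))) (S n)                ∎
    where open ≡-Reasoning

  insertions-↭ : ∀ (x : ℕ) ys → All (_↭ (x ∷ ys)) (insertions x ys)
  insertions-↭ x []       = ↭.refl ∷ []
  insertions-↭ x (y ∷ ys) = ↭.refl ∷ map⁺ (All.map (λ p → ↭.trans (prep y p) (swap y x ↭.refl)) (insertions-↭ x ys))

  perms-↭ : ∀ (xs : List ℕ) → All (_↭ xs) (perms xs)
  perms-↭ []       = ↭.refl ∷ []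
  perms-↭ (x ∷ xs) = concat⁺ (map⁺ (All.map (λ σ↭xs → All.map (λ p → ↭.trans p (prep x σ↭xs)) (insertions-↭ x _))
                                             (perms-↭ xs)))

  IsPerm : ℕ → List ℕ → Set
  IsPerm n σ = length σ ≡ n × Unique σ × All (1 ≤_) σ

  S-isPerm : ∀ n → All (IsPerm n) (S n)
  S-isPerm n = All.map isPerm (perms-↭ (map suc (upTo n)))
    where
    isPerm : ∀ {σ} → σ ↭ map suc (upTo n) → IsPerm n σ
    isPerm σ↭ = trans (↭-length σ↭) (trans (length-map suc (upTo n)) (length-upTo n))
              , Unique-resp-↭ (setoid ℕ) (↭⇒↭ₛ (↭-sym σ↭)) (Unique.map⁺ suc-injective (Unique.upTo⁺ n))
              , All-resp-↭ (↭-sym σ↭) (map⁺ (All.tabulate (λ _ → s≤s z≤n)))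

  ∑-S-cong : ∀ n {f g : List ℕ → ℕ} → (∀ σ → IsPerm n σ → f σ ≡ g σ) → ∑ f (S n) ≡ ∑ g (S n)
  ∑-S-cong n f≡g = ∑-cong (All.map (f≡g _) (S-isPerm n))

  ∑-S-zero : ∀ n {f : List ℕ → ℕ} → (∀ σ → IsPerm n σ → f σ ≡ 0) → ∑ f (S n) ≡ 0
  ∑-S-zero n f≡0 = ∑-zero (All.map (f≡0 _) (S-isPerm n))

  T⇒≡true : ∀ {b} → T b → b ≡ true
  T⇒≡true = Equivalence.to T-≡

  ≡true⇒T : ∀ {b} → b ≡ true → T b
  ≡true⇒T = Equivalence.from T-≡

  ¬T⇒≡false : ∀ {b} → ¬ T b → b ≡ false
  ¬T⇒≡false {false} _  = refl
  ¬T⇒≡false {true}  ¬t = ⊥-elim (¬t tt)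

  ≡false⇒¬T : ∀ {b} → b ≡ false → ¬ T b
  ≡false⇒¬T refl ()

  ≡ᵇ-refl : ∀ n → (n ≡ᵇ n) ≡ true
  ≡ᵇ-refl n = T⇒≡true (≡⇒≡ᵇ n n refl)

  ≡ᵇ-true⇒≡ : ∀ m n → (m ≡ᵇ n) ≡ true → m ≡ n
  ≡ᵇ-true⇒≡ m n = ≡ᵇ⇒≡ m n ∘ ≡true⇒T

  ≢⇒≡ᵇ-false : ∀ {m n} → m ≢ n → (m ≡ᵇ n) ≡ false
  ≢⇒≡ᵇ-false {m} {n} m≢n = ¬T⇒≡false (m≢n ∘ ≡ᵇ⇒≡ m n)

  <⇒<ᵇ-true : ∀ {m n} → m < n → (m <ᵇ n) ≡ true
  <⇒<ᵇ-true = T⇒≡true ∘ <⇒<ᵇ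

  <ᵇ-true⇒< : ∀ m n → (m <ᵇ n) ≡ true → m < n
  <ᵇ-true⇒< m n = <ᵇ⇒< m n ∘ ≡true⇒T

  ≤⇒<ᵇ-false : ∀ {m n} → n ≤ m → (m <ᵇ n) ≡ false
  ≤⇒<ᵇ-false {m} {n} n≤m = ¬T⇒≡false (≤⇒≯ n≤m ∘ <ᵇ⇒< m n)

  <ᵇ-false⇒≤ : ∀ m n → (m <ᵇ n) ≡ false → n ≤ m
  <ᵇ-false⇒≤ m n e = ≮⇒≥ (≡false⇒¬T e ∘ <⇒<ᵇ)

  ≤⇒≤ᵇ-true : ∀ {m n} → m ≤ n → (m ≤ᵇ n) ≡ true
  ≤⇒≤ᵇ-true = T⇒≡true ∘ ≤⇒≤ᵇ

  >⇒≤ᵇ-false : ∀ {m n} → n < m → (m ≤ᵇ n) ≡ false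
  >⇒≤ᵇ-false {m} {n} n<m = ¬T⇒≡false (<⇒≱ n<m ∘ ≤ᵇ⇒≤ m n)

  fixedRun : ℕ → List ℕ → ℕ
  fixedRun i []      = 0
  fixedRun i (a ∷ r) = if a ≡ᵇ i then suc (fixedRun (suc i) r) else 0

  ascRun : List ℕ → ℕ
  ascRun []          = 0
  ascRun (a ∷ [])    = 1
  ascRun (a ∷ b ∷ r) = if a <ᵇ b then suc (ascRun (b ∷ r)) else 1

  hasInversion : List ℕ → Bool
  hasInversion []      = false
  hasInversion (a ∷ r) = any (_<ᵇ a) r ∨ hasInversion r

  Incr : ℕ → List ℕ → Set
  Incr i []       = ⊤
  Incr i (x ∷ xs) = i ≤ x × Incr (suc x) xs

  any-map : ∀ (p : ℕ → Bool) (f : ℕ → ℕ) xs → any p (map f xs) ≡ any (p ∘ f) xs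
  any-map p f []       = refl
  any-map p f (x ∷ xs) = cong (p (f x) ∨_) (any-map p f xs)

  decPair-map-suc : ∀ a r → decPair (suc a) (map suc r) ≡ decPair a r
  decPair-map-suc a []      = refl
  decPair-map-suc a (b ∷ r) =
    cong₂ (λ u v → ((b <ᵇ a) ∧ u) ∨ v) (any-map (_<ᵇ suc b) suc r) (decPair-map-suc a r)

  contains321-map-suc : ∀ σ → contains321 (map suc σ) ≡ contains321 σ
  contains321-map-suc []      = refl
  contains321-map-suc (a ∷ r) = cong₂ _∨_ (decPair-map-suc a r) (contains321-map-suc r)

  hasInversion-map-suc : ∀ σ → hasInversion (map suc σ) ≡ hasInversion σ
  hasInversion-map-suc []      = refl
  hasInversion-map-suc (a ∷ r) = cong₂ _∨_ (any-map (_<ᵇ suc a) suc r) (hasInversion-map-suc r)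

  fixFrom-map-suc : ∀ i σ → fixFrom (suc i) (map suc σ) ≡ fixFrom i σ
  fixFrom-map-suc i []      = refl
  fixFrom-map-suc i (a ∷ r) = cong ((if a ≡ᵇ i then 1 else 0) +_) (fixFrom-map-suc (suc i) r)

  fixedRun-map-suc : ∀ i σ → fixedRun (suc i) (map suc σ) ≡ fixedRun i σ
  fixedRun-map-suc i []      = refl
  fixedRun-map-suc i (a ∷ r) with a ≡ᵇ i
  ... | true  = cong suc (fixedRun-map-suc (suc i) r)
  ... | false = refl

  ascRun-map-suc : ∀ σ → ascRun (map suc σ) ≡ ascRun σ
  ascRun-map-suc []          = refl
  ascRun-map-suc (a ∷ [])    = refl
  ascRun-map-suc (a ∷ b ∷ r) = cong (λ z → if a <ᵇ b then suc z else 1) (ascRun-map-suc (b ∷ r))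

  fixedRun≤fixFrom : ∀ i σ → fixedRun i σ ≤ fixFrom i σ
  fixedRun≤fixFrom i []      = z≤n
  fixedRun≤fixFrom i (a ∷ r) with a ≡ᵇ i
  ... | true  = s≤s (fixedRun≤fixFrom (suc i) r)
  ... | false = z≤n

  fixFrom≤length : ∀ i σ → fixFrom i σ ≤ length σ
  fixFrom≤length i []      = z≤n
  fixFrom≤length i (a ∷ r) with a ≡ᵇ i
  ... | true  = s≤s (fixFrom≤length (suc i) r)
  ... | false = m≤n⇒m≤1+n (fixFrom≤length (suc i) r)

  ascRun≤length : ∀ σ → ascRun σ ≤ length σ
  ascRun≤length []          = z≤n
  ascRun≤length (a ∷ [])    = s≤s z≤n
  ascRun≤length (a ∷ b ∷ r) with ascRun≤length (b ∷ r) | a <ᵇ b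
  ... | ih | true  = s≤s ih
  ... | _  | false = s≤s z≤n

  fixedRun≤ascRun : ∀ i σ → fixedRun i σ ≤ ascRun σ
  fixedRun≤ascRun i []          = z≤n
  fixedRun≤ascRun i (a ∷ [])    with a ≡ᵇ i
  ... | true  = s≤s z≤n
  ... | false = z≤n
  fixedRun≤ascRun i (a ∷ b ∷ r) with fixedRun≤ascRun (suc i) (b ∷ r) | a ≡ᵇ i in a≡i
  ... | _  | false = z≤n
  ... | ih | true  with b ≡ᵇ suc i in b≡1+i
  ...   | true  rewrite ≡ᵇ-true⇒≡ a i a≡i | ≡ᵇ-true⇒≡ b (suc i) b≡1+i | <⇒<ᵇ-true (n<1+n i) = s≤s ih
  ...   | false with a <ᵇ b
  ...     | true  = s≤s z≤n
  ...     | false = s≤s z≤n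

  fixedRun-take : ∀ i p xs → fixedRun i (take p xs) ≡ p ⊓ fixedRun i xs
  fixedRun-take i zero    xs       = refl
  fixedRun-take i (suc p) []       = refl
  fixedRun-take i (suc p) (x ∷ xs) with x ≡ᵇ i
  ... | true  = cong suc (fixedRun-take (suc i) p xs)
  ... | false = refl

  fixFrom-++ : ∀ i xs ys → fixFrom i (xs ++ ys) ≡ fixFrom i xs + fixFrom (length xs + i) ys
  fixFrom-++ i []       ys = refl
  fixFrom-++ i (x ∷ xs) ys rewrite fixFrom-++ (suc i) xs ys | +-suc (length xs) i =
    sym (+-assoc (if x ≡ᵇ i then 1 else 0) _ _)

  Incr-weaken : ∀ {i j} xs → j ≤ i → Incr i xs → Incr j xs
  Incr-weaken []       _   _            = tt
  Incr-weaken (x ∷ xs) j≤i (i≤x , incr) = ≤-trans j≤i i≤x , incr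

  Incr-map-suc : ∀ {i} xs → Incr i xs → Incr (suc i) (map suc xs)
  Incr-map-suc []       _            = tt
  Incr-map-suc (x ∷ xs) (i≤x , incr) = s≤s i≤x , Incr-map-suc xs incr

  Incr⇒All≥ : ∀ {i} xs → Incr i xs → All (i ≤_) xs
  Incr⇒All≥ []       _            = []
  Incr⇒All≥ (x ∷ xs) (i≤x , incr) = i≤x ∷ All.map (≤-trans (m≤n⇒m≤1+n i≤x)) (Incr⇒All≥ xs incr)

  fixFrom-Incr-above : ∀ {i} xs → Incr (suc i) xs → fixFrom i xs ≡ 0
  fixFrom-Incr-above           []       _            = refl
  fixFrom-Incr-above {i} (x ∷ xs) (i<x , incr) rewrite ≢⇒≡ᵇ-false (>⇒≢ i<x) =
    fixFrom-Incr-above xs (Incr-weaken xs (s≤s i<x) incr)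

  fixFrom-Incr : ∀ {i} xs → Incr i xs → fixFrom i xs ≡ fixedRun i xs
  fixFrom-Incr           []       _            = refl
  fixFrom-Incr {i} (x ∷ xs) (i≤x , incr) with x ≡ᵇ i in x≡ᵇi
  ... | true rewrite ≡ᵇ-true⇒≡ x i x≡ᵇi = cong suc (fixFrom-Incr xs incr)
  ... | false = fixFrom-Incr-above xs (Incr-weaken xs (s≤s (≤∧≢⇒< i≤x i≢x)) incr)
    where
    i≢x : i ≢ x
    i≢x refl = ≡false⇒¬T x≡ᵇi (≡⇒≡ᵇ x x refl)

  any-<ᵇ-false : ∀ {c} ys → All (c <_) ys → any (_<ᵇ c) ys ≡ false
  any-<ᵇ-false []       []           = refl
  any-<ᵇ-false (y ∷ ys) (c<y ∷ c<ys) rewrite ≤⇒<ᵇ-false {y} (<⇒≤ c<y) = any-<ᵇ-false ys c<ys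

  hasInversion-Incr : ∀ {i} xs → Incr i xs → hasInversion xs ≡ false
  hasInversion-Incr []       _            = refl
  hasInversion-Incr (x ∷ xs) (_ , incr) rewrite any-<ᵇ-false xs (Incr⇒All≥ xs incr) = hasInversion-Incr xs incr

  Incr-take : ∀ {i} b r q → i ≤ b → q ≤ ascRun (b ∷ r) → Incr i (take q (b ∷ r))
  Incr-take b []      zero          i≤b _ = tt
  Incr-take b []      (suc zero)    i≤b _ = i≤b , tt
  Incr-take b []      (suc (suc q)) i≤b (s≤s ())
  Incr-take b (c ∷ r) zero          i≤b _ = tt
  Incr-take b (c ∷ r) (suc q)       i≤b q≤run with b <ᵇ c in b<ᵇc
  ... | true  = i≤b , Incr-take c r q (<ᵇ-true⇒< b c b<ᵇc) (≤-pred q≤run)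
  Incr-take b (c ∷ r) (suc zero)    i≤b _          | false = i≤b , tt
  Incr-take b (c ∷ r) (suc (suc q)) i≤b (s≤s ())   | false

  hasInversion-take : ∀ σ p → Unique σ → ascRun σ < p → p ≤ length σ → hasInversion (take p σ) ≡ true
  hasInversion-take (a ∷ b ∷ r) (suc q) ((a≢b ∷ _) ∷ u) run<p p≤len with a <ᵇ b in a<ᵇb
  ... | true rewrite hasInversion-take (b ∷ r) q u (≤-pred run<p) (≤-pred p≤len) = ∨-zeroʳ _
  hasInversion-take (a ∷ b ∷ r) (suc (suc q)) ((a≢b ∷ _) ∷ _) _ _ | false
    rewrite <⇒<ᵇ-true (≤∧≢⇒< (<ᵇ-false⇒≤ a b a<ᵇb) (a≢b ∘ sym)) = refl
  hasInversion-take (a ∷ b ∷ r) (suc zero) _ (s≤s ()) _ | false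
  hasInversion-take []      p _ run<p p≤len = ⊥-elim (<-irrefl refl (≤-trans run<p p≤len))
  hasInversion-take (a ∷ []) p _ run<p p≤len = ⊥-elim (<-irrefl refl (≤-trans run<p p≤len))

  ascRun-++ : ∀ {c} x xs ys → Incr (suc c) (x ∷ xs) → ascRun ((x ∷ xs) ++ c ∷ ys) ≡ length (x ∷ xs)
  ascRun-++ {c} x []       ys (c<x , _) rewrite ≤⇒<ᵇ-false {x} {c} (<⇒≤ c<x) = refl
  ascRun-++ {c} x (y ∷ xs) ys (c<x , x<y , incr) rewrite <⇒<ᵇ-true x<y =
    cong suc (ascRun-++ y xs ys (≤-trans (s≤s (<⇒≤ c<x)) x<y , incr))

  decPair-above : ∀ {c} ys → All (c <_) ys → decPair c ys ≡ false
  decPair-above []       []           = refl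
  decPair-above (y ∷ ys) (c<y ∷ c<ys) rewrite ≤⇒<ᵇ-false {y} (<⇒≤ c<y) = decPair-above ys c<ys

  any-<ᵇ-middle : ∀ {c b} xs ys → c < b → any (_<ᵇ b) (xs ++ c ∷ ys) ≡ true
  any-<ᵇ-middle []       ys c<b rewrite <⇒<ᵇ-true c<b = refl
  any-<ᵇ-middle {b = b} (x ∷ xs) ys c<b rewrite any-<ᵇ-middle xs ys c<b = ∨-zeroʳ (x <ᵇ b)

  decPair-insert-min : ∀ {c a} xs ys → c < a → All (c <_) xs → All (c <_) ys →
    decPair a (xs ++ c ∷ ys) ≡ decPair a (xs ++ ys) ∨ any (_<ᵇ a) xs
  decPair-insert-min []       ys c<a _            c<ys rewrite <⇒<ᵇ-true c<a | any-<ᵇ-false ys c<ys =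
    sym (∨-identityʳ _)
  decPair-insert-min {a = a} (b ∷ xs) ys c<a (c<b ∷ c<xs) c<ys
    rewrite any-<ᵇ-middle xs ys c<b | decPair-insert-min xs ys c<a c<xs c<ys with b <ᵇ a
  ... | true  = sym (∨-zeroʳ _)
  ... | false = refl

  contains321-insert-min : ∀ {c} xs ys → All (c <_) xs → All (c <_) ys →
    contains321 (xs ++ c ∷ ys) ≡ contains321 (xs ++ ys) ∨ hasInversion xs
  contains321-insert-min []       ys _            c<ys rewrite decPair-above ys c<ys = sym (∨-identityʳ _)
  contains321-insert-min (a ∷ xs) ys (c<a ∷ c<xs) c<ys
    rewrite decPair-insert-min xs ys c<a c<xs c<ys | contains321-insert-min xs ys c<xs c<ys =
    ∨-interchange (decPair a (xs ++ ys)) (any (_<ᵇ a) xs) (contains321 (xs ++ ys)) (hasInversion xs)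

  ∑-insertions : ∀ (h : List ℕ → ℕ) x ys →
    ∑ h (insertions x ys) ≡ ∑< (suc (length ys)) (λ p → h (take p ys ++ x ∷ drop p ys))
  ∑-insertions h x []       = refl
  ∑-insertions h x (y ∷ ys) =
    cong (h (x ∷ y ∷ ys) +_) (trans (∑-map h (y ∷_) (insertions x ys)) (∑-insertions (h ∘ (y ∷_)) x ys))

  child : List ℕ → ℕ → List ℕ
  child σ p = map suc (take p σ) ++ 1 ∷ map suc (drop p σ)

  ∑-insertions-child : ∀ (h : List ℕ → ℕ) σ → ∑ h (insertions 1 (map suc σ)) ≡ ∑< (suc (length σ)) (h ∘ child σ)
  ∑-insertions-child h σ rewrite ∑-insertions h 1 (map suc σ) | length-map suc σ =
    ∑<-cong (suc (length σ)) (λ p → cong₂ (λ xs ys → h (xs ++ 1 ∷ ys)) (take-map {f = suc} p σ) (drop-map {f = suc} p σ))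

  avoids321-child : ∀ σ p → All (1 ≤_) σ → avoids321 (child σ p) ≡ avoids321 σ ∧ not (hasInversion (take p σ))
  avoids321-child σ p 1≤σ rewrite contains321-insert-min (map suc (take p σ)) (map suc (drop p σ))
                                     (map⁺ (All.map s≤s (take⁺ p 1≤σ))) (map⁺ (All.map s≤s (drop⁺ p 1≤σ)))
                                | sym (map-++ suc (take p σ) (drop p σ)) | take++drop≡id p σ
                                | contains321-map-suc σ | hasInversion-map-suc (take p σ)
    with contains321 σ | hasInversion (take p σ)
  ... | true  | _ = refl
  ... | false | true  = refl
  ... | false | false = refl

  leadingFixed : List ℕ → ℕ
  leadingFixed = fixedRun 1

  otherFixed : List ℕ → ℕ
  otherFixed σ = fp σ ∸ leadingFixed σ

  ascRun-child-zero : ∀ σ → All (1 ≤_) σ → ascRun (child σ 0) ≡ suc (ascRun σ)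
  ascRun-child-zero []          _             = refl
  ascRun-child-zero (suc b ∷ r) (s≤s z≤n ∷ _) = cong suc (ascRun-map-suc (suc b ∷ r))

  o≡[m⊓n+o∸n]+[n∸m] : ∀ m n o → n ≤ m ⊓ n + o → o ≡ (m ⊓ n + o ∸ n) + (n ∸ m)
  o≡[m⊓n+o∸n]+[n∸m] zero    n       o n≤o         = sym (m∸n+n≡m n≤o)
  o≡[m⊓n+o∸n]+[n∸m] (suc m) zero    o _           = sym (+-identityʳ o)
  o≡[m⊓n+o∸n]+[n∸m] (suc m) (suc n) o (s≤s n≤m⊓n+o) = o≡[m⊓n+o∸n]+[n∸m] m n o n≤m⊓n+o

  -- The fixed points of σ among its first q + 1 entries are lost, all others survive.
  child-suc-stats : ∀ σ q → All (1 ≤_) σ → suc q ≤ ascRun σ →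
    leadingFixed (child σ (suc q)) ≡ 0 × ascRun (child σ (suc q)) ≡ suc q ×
    fp (child σ (suc q)) ≡ otherFixed σ + (leadingFixed σ ∸ suc q)
  child-suc-stats (b ∷ r) q (1≤b ∷ _) q<run = leading≡0 , run≡1+q , fp-child
    where
    σ = b ∷ r
    P = take (suc q) σ
    R = drop (suc q) σ
    m = leadingFixed σ
    incr : Incr 1 P
    incr = Incr-take b r (suc q) 1≤b q<run
    length-P : length P ≡ suc q
    length-P = cong suc (trans (length-take q r) (m≤n⇒m⊓n≡m (≤-pred (≤-trans q<run (ascRun≤length σ)))))
    leading≡0 : leadingFixed (child σ (suc q)) ≡ 0
    leading≡0 rewrite ≢⇒≡ᵇ-false (>⇒≢ (s≤s 1≤b)) = refl
    run≡1+q : ascRun (child σ (suc q)) ≡ suc q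
    run≡1+q = trans (ascRun-++ (suc b) (map suc (take q r)) (map suc R) (Incr-map-suc P incr))
                    (trans (length-map suc P) length-P)
    fp-child-tail : fp (child σ (suc q)) ≡ fixFrom (2 + q) R
    fp-child-tail = begin
      fixFrom 1 (map suc P ++ 1 ∷ map suc R)
        ≡⟨ fixFrom-++ 1 (map suc P) (1 ∷ map suc R) ⟩
      fixFrom 1 (map suc P) + fixFrom (length (map suc P) + 1) (1 ∷ map suc R)
        ≡⟨ cong₂ _+_ (trans (fixFrom-map-suc 0 P) (fixFrom-Incr-above P incr))
                     (cong (λ i → fixFrom (i + 1) (1 ∷ map suc R)) (trans (length-map suc P) length-P)) ⟩
      fixFrom (suc q + 1) (1 ∷ map suc R)
        ≡⟨ cong (λ i → fixFrom i (1 ∷ map suc R)) (+-comm (suc q) 1) ⟩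
      fixFrom (2 + q) (1 ∷ map suc R)
        ≡⟨ fixFrom-map-suc (2 + q) R ⟩
      fixFrom (2 + q) R ∎
      where open ≡-Reasoning
    fp-split : fp σ ≡ suc q ⊓ m + fp (child σ (suc q))
    fp-split = begin
      fixFrom 1 σ                              ≡⟨ cong (fixFrom 1) (take++drop≡id (suc q) σ) ⟨
      fixFrom 1 (P ++ R)                       ≡⟨ fixFrom-++ 1 P R ⟩
      fixFrom 1 P + fixFrom (length P + 1) R   ≡⟨ cong₂ _+_ (trans (fixFrom-Incr P incr) (fixedRun-take 1 (suc q) σ))
                                                            (cong (λ i → fixFrom (i + 1) R) length-P) ⟩
      suc q ⊓ m + fixFrom (suc q + 1) R        ≡⟨ cong (λ i → suc q ⊓ m + fixFrom i R) (+-comm (suc q) 1) ⟩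
      suc q ⊓ m + fixFrom (2 + q) R            ≡⟨ cong (suc q ⊓ m +_) fp-child-tail ⟨
      suc q ⊓ m + fp (child σ (suc q))         ∎
      where open ≡-Reasoning
    fp-child : fp (child σ (suc q)) ≡ otherFixed σ + (m ∸ suc q)
    fp-child = trans (o≡[m⊓n+o∸n]+[n∸m] (suc q) m (fp (child σ (suc q))) (subst (m ≤_) fp-split (fixedRun≤fixFrom 1 σ)))
                     (cong (λ f → (f ∸ m) + (m ∸ suc q)) (sym fp-split))

  Cpred : ℕ → ℕ → ℕ
  Cpred n zero    = 0
  Cpred n (suc k) = n C k

  C-suc : ∀ n k → suc n C k ≡ Cpred n k + n C k
  C-suc n zero    = refl
  C-suc n (suc k) = sym (nCk+nC[k+1]≡[n+1]C[k+1] n k)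

  -- r, m and L stand for otherFixed σ, leadingFixed σ and ascRun σ.
  φ : (r m L e k : ℕ) → ℕ
  φ r m L e k = ind (e ≡ᵇ L) (r C k) + ind (e <ᵇ m) (Cpred (r + (m ∸ suc e)) k)

  ψ : (r m L e k : ℕ) → ℕ
  ψ r m L e k = ind (e ≤ᵇ L) ((r + (m ∸ e)) C k)

  ψ-suc : ∀ r m L e k → m ≤ L → ψ r m L e k ≡ φ r m L e k + ψ r m L (suc e) k
  ψ-suc r m L e k m≤L with <-cmp e L
  ... | tri< e<L e≢L _ rewrite ≤⇒≤ᵇ-true (<⇒≤ e<L) | ≢⇒≡ᵇ-false e≢L | <⇒<ᵇ-true e<L with e <ᵇ m in e<ᵇm
  ...   | true  rewrite +-∸-assoc 1 (<ᵇ-true⇒< e m e<ᵇm) | +-suc r (m ∸ suc e) = C-suc (r + (m ∸ suc e)) k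
  ...   | false rewrite m≤n⇒m∸n≡0 (<ᵇ-false⇒≤ e m e<ᵇm)
                      | m≤n⇒m∸n≡0 (m≤n⇒m≤1+n (<ᵇ-false⇒≤ e m e<ᵇm)) = refl
  ψ-suc r m L e k m≤L | tri≈ _ refl _
    rewrite ≤⇒≤ᵇ-true (≤-refl {e}) | ≡ᵇ-refl e | ≤⇒<ᵇ-false {e} {m} m≤L | ≤⇒<ᵇ-false {e} {e} ≤-refl
          | m≤n⇒m∸n≡0 m≤L | +-identityʳ r = sym (trans (+-identityʳ _) (+-identityʳ _))
  ψ-suc r m L e k m≤L | tri> _ e≢L L<e
    rewrite >⇒≤ᵇ-false L<e | ≢⇒≡ᵇ-false e≢L | ≤⇒<ᵇ-false {e} {m} (≤-trans m≤L (<⇒≤ L<e))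
          | ≤⇒<ᵇ-false (<⇒≤ L<e) = refl

  childWeight : (r m L e k : ℕ) → ℕ
  childWeight r m L zero    zero    = 0
  childWeight r m L zero    (suc k) = ψ r m L 0 k
  childWeight r m L (suc e) k       = φ r m L e k + ψ r m L (suc e) k

  φ+pick≡childWeight : ∀ r m L e k → φ r (suc m) (suc L) e k + pick L e (λ q → (r + (m ∸ suc q)) C k) ≡ childWeight r m L e k
  φ+pick≡childWeight r m L zero    zero    = refl
  φ+pick≡childWeight r m L zero    (suc k) = +-identityʳ _
  φ+pick≡childWeight r m L (suc e) k       = refl

  Φ : List ℕ → ℕ → ℕ → ℕ
  Φ σ = φ (otherFixed σ) (leadingFixed σ) (ascRun σ)

  Ψ : List ℕ → ℕ → ℕ → ℕ
  Ψ σ = ψ (otherFixed σ) (leadingFixed σ) (ascRun σ)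

  hasInversion-take-ascRun : ∀ σ p → p ≤ ascRun σ → hasInversion (take p σ) ≡ false
  hasInversion-take-ascRun []      zero _   = refl
  hasInversion-take-ascRun (b ∷ r) p    p≤L = hasInversion-Incr (take p (b ∷ r)) (Incr-take {0} b r p z≤n p≤L)

  ∑-children-Φ : ∀ σ e k → Unique σ → All (1 ≤_) σ →
    ∑ (λ π → ind (avoids321 π) (Φ π e k)) (insertions 1 (map suc σ))
      ≡ ind (avoids321 σ) (childWeight (otherFixed σ) (leadingFixed σ) (ascRun σ) e k)
  ∑-children-Φ σ e k u 1≤σ = trans (∑-insertions-child h σ) children
    where
    r = otherFixed σ
    m = leadingFixed σ
    L = ascRun σ
    h : List ℕ → ℕ
    h π = ind (avoids321 π) (Φ π e k)
    F : ℕ → ℕ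
    F = h ∘ child σ
    g : ℕ → ℕ
    g q = (r + (m ∸ suc q)) C k
    children : ∑< (suc (length σ)) F ≡ ind (avoids321 σ) (childWeight r m L e k)
    children with avoids321 σ in σ-avoids
    ... | false = ∑<-zero (suc (length σ)) F
                    (λ p _ → cong (λ b → ind b (Φ (child σ p) e k))
                                  (trans (avoids321-child σ p 1≤σ) (cong (_∧ not (hasInversion (take p σ))) σ-avoids)))
    ... | true  = trans (cong₂ _+_ F0 Fs) (φ+pick≡childWeight r m L e k)
      where
      child-avoids : ∀ p → avoids321 (child σ p) ≡ not (hasInversion (take p σ))
      child-avoids p = trans (avoids321-child σ p 1≤σ) (cong (_∧ not (hasInversion (take p σ))) σ-avoids)
      F0 : F 0 ≡ φ r (suc m) (suc L) e k
      F0 rewrite child-avoids 0 | fixFrom-map-suc 1 σ | fixedRun-map-suc 1 σ | ascRun-child-zero σ 1≤σ = refl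
      Fq : ∀ q → q < L → F (suc q) ≡ ind (e ≡ᵇ suc q) (g q)
      Fq q q<L with child-suc-stats σ q 1≤σ q<L
      ... | leading≡0 , run≡ , fp≡ rewrite child-avoids (suc q) | hasInversion-take-ascRun σ (suc q) q<L
                                           | leading≡0 | run≡ | fp≡ = +-identityʳ _
      Fz : ∀ q → L ≤ q → q < length σ → F (suc q) ≡ 0
      Fz q L≤q q<len rewrite child-avoids (suc q) | hasInversion-take σ (suc q) u (s≤s L≤q) q<len = refl
      Fs : ∑< (length σ) (F ∘ suc) ≡ pick L e g
      Fs = trans (∑<-restrict L (length σ) (F ∘ suc) _ (ascRun≤length σ) Fq Fz) (∑<-pick L e g)

  Tφ : ℕ → ℕ → ℕ → ℕ
  Tφ n e k = ∑ (λ σ → ind (avoids321 σ) (Φ σ e k)) (S n)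

  Tψ : ℕ → ℕ → ℕ → ℕ
  Tψ n e k = ∑ (λ σ → ind (avoids321 σ) (Ψ σ e k)) (S n)

  Tφ-suc : ∀ n e k →
    Tφ (suc n) e k ≡ ∑ (λ σ → ind (avoids321 σ) (childWeight (otherFixed σ) (leadingFixed σ) (ascRun σ) e k)) (S n)
  Tφ-suc n e k = trans (∑-S-suc n (λ π → ind (avoids321 π) (Φ π e k)))
                       (∑-S-cong n (λ σ (_ , u , 1≤σ) → ∑-children-Φ σ e k u 1≤σ))

  Tφ-suc-zero-zero : ∀ n → Tφ (suc n) 0 0 ≡ 0
  Tφ-suc-zero-zero n = trans (Tφ-suc n 0 0) (∑-S-zero n (λ σ _ → ind-0 (avoids321 σ)))

  Tφ-suc-zero-suc : ∀ n k → Tφ (suc n) 0 (suc k) ≡ Tψ n 0 k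
  Tφ-suc-zero-suc n k = Tφ-suc n 0 (suc k)

  Tφ-suc-suc : ∀ n e k → Tφ (suc n) (suc e) k ≡ Tφ n e k + Tψ n (suc e) k
  Tφ-suc-suc n e k = trans (Tφ-suc n (suc e) k) (trans (∑-S-cong n (λ σ _ → ind-+ (avoids321 σ) _ _)) (∑-+ _ _ (S n)))

  Tψ-suc : ∀ n e k → Tψ n e k ≡ Tφ n e k + Tψ n (suc e) k
  Tψ-suc n e k = trans (∑-S-cong n (λ σ _ → trans (cong (ind (avoids321 σ)) (ψ-suc _ _ _ e k (fixedRun≤ascRun 1 σ)))
                                                  (ind-+ (avoids321 σ) _ _)))
                       (∑-+ _ _ (S n))

  Tψ-above : ∀ n e k → n < e → Tψ n e k ≡ 0
  Tψ-above n e k n<e = ∑-S-zero n (λ σ (length≡n , _) → trans (cong (ind (avoids321 σ)) (Ψ≡0 σ length≡n)) (ind-0 (avoids321 σ)))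
    where
    Ψ≡0 : ∀ σ → length σ ≡ n → Ψ σ e k ≡ 0
    Ψ≡0 σ length≡n rewrite >⇒≤ᵇ-false (≤-<-trans (ascRun≤length σ) (subst (_< e) (sym length≡n) n<e)) = refl

  -- Summing the invariant over e ≥ e₀ transfers it from Tφ to Tψ.
  Tψ-shift : ∀ n → (∀ d k → Tφ n (suc d) k ≡ Tφ n d (suc k)) → ∀ e k → Tψ n (suc e) k ≡ Tψ n e (suc k)
  Tψ-shift n Tφ-shift e k = shift n e k (m≤n+m n e)
    where
    open ≡-Reasoning
    shift : ∀ j e k → n ≤ e + j → Tψ n (suc e) k ≡ Tψ n e (suc k)
    shift zero e k n≤e+0 = begin
      Tψ n (suc e) k                                ≡⟨ Tψ-above n (suc e) k n<1+e ⟩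
      0                                             ≡⟨ m+n≡0⇒m≡0 (Tφ n (suc e) k)
                                                         (trans (sym (Tψ-suc n (suc e) k)) (Tψ-above n (suc e) k n<1+e)) ⟨
      Tφ n (suc e) k                                ≡⟨ Tφ-shift e k ⟩
      Tφ n e (suc k)                                ≡⟨ +-identityʳ _ ⟨
      Tφ n e (suc k) + 0                            ≡⟨ cong (Tφ n e (suc k) +_) (Tψ-above n (suc e) (suc k) n<1+e) ⟨
      Tφ n e (suc k) + Tψ n (suc e) (suc k)         ≡⟨ Tψ-suc n e (suc k) ⟨
      Tψ n e (suc k)                                ∎
      where
      n<1+e : n < suc e
      n<1+e = s≤s (subst (n ≤_) (+-identityʳ e) n≤e+0)
    shift (suc j) e k n≤e+1+j = begin
      Tψ n (suc e) k                                ≡⟨ Tψ-suc n (suc e) k ⟩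
      Tφ n (suc e) k + Tψ n (suc (suc e)) k         ≡⟨ cong₂ _+_ (Tφ-shift e k)
                                                                 (shift j (suc e) k (subst (n ≤_) (+-suc e j) n≤e+1+j)) ⟩
      Tφ n e (suc k) + Tψ n (suc e) (suc k)         ≡⟨ Tψ-suc n e (suc k) ⟨
      Tψ n e (suc k)                                ∎

  Tφ-shift : ∀ n d k → Tφ n (suc d) k ≡ Tφ n d (suc k)
  Tφ-shift zero    zero    k = refl
  Tφ-shift zero    (suc d) k = refl
  Tφ-shift (suc n) zero    k = begin
    Tφ (suc n) 1 k              ≡⟨ Tφ-suc-suc n 0 k ⟩
    Tφ n 0 k + Tψ n 1 k         ≡⟨ Tψ-suc n 0 k ⟨
    Tψ n 0 k                    ≡⟨ Tφ-suc-zero-suc n k ⟨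
    Tφ (suc n) 0 (suc k)        ∎
    where open ≡-Reasoning
  Tφ-shift (suc n) (suc d) k = begin
    Tφ (suc n) (suc (suc d)) k                ≡⟨ Tφ-suc-suc n (suc d) k ⟩
    Tφ n (suc d) k + Tψ n (suc (suc d)) k     ≡⟨ cong₂ _+_ (Tφ-shift n d k) (Tψ-shift n (Tφ-shift n) (suc d) k) ⟩
    Tφ n d (suc k) + Tψ n (suc d) (suc k)     ≡⟨ Tφ-suc-suc n d (suc k) ⟨
    Tφ (suc n) (suc d) (suc k)                ∎
    where open ≡-Reasoning

  fixBinomSum : ℕ → ℕ → ℕ
  fixBinomSum n k = ∑ (λ π → fp π C k) (S321 n)

  S321-fp≤ : ∀ n → All (λ π → fp π ≤ n) (S321 n)
  S321-fp≤ n = filter⁺ (λ π → avoids321 π ≟ true)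
                 (All.map (λ {σ} (length≡n , _) → subst (fp σ ≤_) length≡n (fixFrom≤length 1 σ)) (S-isPerm n))

  fixBinomSum-above : ∀ n k → n < k → fixBinomSum n k ≡ 0
  fixBinomSum-above n k n<k = ∑-zero (All.map (λ fp≤n → k>n⇒nCk≡0 (≤-<-trans fp≤n n<k)) (S321-fp≤ n))

  fixBinomSum≡Tψ : ∀ n k → fixBinomSum n k ≡ Tψ n 0 k
  fixBinomSum≡Tψ n k = trans (∑-filter avoids321 (λ π → fp π C k) (S n))
    (∑-S-cong n (λ σ _ → cong (λ f → ind (avoids321 σ) (f C k)) (sym (m∸n+n≡m (fixedRun≤fixFrom 1 σ)))))

  fixBinomSum-split : ∀ n k → fixBinomSum (suc n) k ≡ Tφ (suc n) 0 k + fixBinomSum (suc n) (suc k)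
  fixBinomSum-split n k = begin
    fixBinomSum (suc n) k                         ≡⟨ fixBinomSum≡Tψ (suc n) k ⟩
    Tψ (suc n) 0 k                                ≡⟨ Tψ-suc (suc n) 0 k ⟩
    Tφ (suc n) 0 k + Tψ (suc n) 1 k               ≡⟨ cong (Tφ (suc n) 0 k +_) (Tψ-shift (suc n) (Tφ-shift (suc n)) 0 k) ⟩
    Tφ (suc n) 0 k + Tψ (suc n) 0 (suc k)         ≡⟨ cong (Tφ (suc n) 0 k +_) (fixBinomSum≡Tψ (suc n) (suc k)) ⟨
    Tφ (suc n) 0 k + fixBinomSum (suc n) (suc k)  ∎
    where open ≡-Reasoning

  fixBinomSum-suc-zero : ∀ n → fixBinomSum (suc n) 0 ≡ fixBinomSum (suc n) 1
  fixBinomSum-suc-zero n = trans (fixBinomSum-split n 0) (cong (_+ fixBinomSum (suc n) 1) (Tφ-suc-zero-zero n))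

  fixBinomSum-suc-suc : ∀ n k → fixBinomSum (suc n) (suc k) ≡ fixBinomSum (suc n) (2 + k) + fixBinomSum n k
  fixBinomSum-suc-suc n k = begin
    fixBinomSum (suc n) (suc k)                        ≡⟨ fixBinomSum-split n (suc k) ⟩
    Tφ (suc n) 0 (suc k) + fixBinomSum (suc n) (2 + k) ≡⟨ cong (_+ fixBinomSum (suc n) (2 + k)) (Tφ-suc-zero-suc n k) ⟩
    Tψ n 0 k + fixBinomSum (suc n) (2 + k)             ≡⟨ cong (_+ fixBinomSum (suc n) (2 + k)) (fixBinomSum≡Tψ n k) ⟨
    fixBinomSum n k + fixBinomSum (suc n) (2 + k)      ≡⟨ +-comm (fixBinomSum n k) _ ⟩
    fixBinomSum (suc n) (2 + k) + fixBinomSum n k      ∎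
    where open ≡-Reasoning

module Coefficients where

  open Counting using (∑; fixBinomSum; S321-fp≤)
  open import Data.Integer using (ℤ; +_; -[1+_]; _+_; _*_; -_; _-_)
  open import Data.Integer.Properties
    using (+-identityˡ; +-identityʳ; +-assoc; *-identityʳ; *-zeroʳ; *-distribˡ-+; *-distribʳ-+; +-0-abelianGroup; +-commutativeSemigroup)
  open import Data.Integer.Solver using (module +-*-Solver)
  open import Data.List using (List; []; _∷_; map; foldr; upTo; applyUpTo)
  open import Data.List.Properties using (map-upTo)
  open import Data.List.Relation.Unary.All as All using (All; []; _∷_)
  open import Data.Nat as ℕ using (ℕ; zero; suc; z≤n; s≤s; z<s)
  open import Data.Nat.Combinatorics using (_C_; nCk+nC[k+1]≡[n+1]C[k+1]; k>n⇒nCk≡0)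
  import Data.Nat.Properties as ℕ
  open import Data.Sum using (inj₁; inj₂)
  open import Function using (_∘_)
  open import Relation.Binary.PropositionalEquality using (_≡_; refl; sym; trans; cong; cong₂; subst; module ≡-Reasoning)
  open import Algebra.Properties.AbelianGroup +-0-abelianGroup using (∙-cancelʳ)
  open import Algebra.Properties.CommutativeSemigroup +-commutativeSemigroup
    using () renaming (interchange to +-interchange)
  open +-*-Solver

  ∑ℤ : {A : Set} → (A → ℤ) → List A → ℤ
  ∑ℤ f []       = + 0
  ∑ℤ f (x ∷ xs) = f x + ∑ℤ f xs

  ∑ℤ-cong : {A : Set} {f g : A → ℤ} {xs : List A} → All (λ x → f x ≡ g x) xs → ∑ℤ f xs ≡ ∑ℤ g xs
  ∑ℤ-cong []       = refl
  ∑ℤ-cong (p ∷ ps) = cong₂ _+_ p (∑ℤ-cong ps)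

  ∑ℤ-map : {A B : Set} (f : B → ℤ) (g : A → B) (xs : List A) → ∑ℤ f (map g xs) ≡ ∑ℤ (f ∘ g) xs
  ∑ℤ-map f g []       = refl
  ∑ℤ-map f g (x ∷ xs) = cong (_+_ (f (g x))) (∑ℤ-map f g xs)

  ∑ℤ-*-pos : {A : Set} (f : A → ℕ) (c : ℤ) (xs : List A) → ∑ℤ (λ x → + f x * c) xs ≡ + ∑ f xs * c
  ∑ℤ-*-pos f c []       = refl
  ∑ℤ-*-pos f c (x ∷ xs) = trans (cong (_+_ (+ f x * c)) (∑ℤ-*-pos f c xs)) (sym (*-distribʳ-+ c (+ f x) (+ ∑ f xs)))

  ∑<ℤ : ℕ → (ℕ → ℤ) → ℤ
  ∑<ℤ zero    f = + 0
  ∑<ℤ (suc n) f = f 0 + ∑<ℤ n (f ∘ suc)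

  ∑<ℤ-cong : ∀ n {f g : ℕ → ℤ} → (∀ k → k ℕ.< n → f k ≡ g k) → ∑<ℤ n f ≡ ∑<ℤ n g
  ∑<ℤ-cong zero    f≡g = refl
  ∑<ℤ-cong (suc n) f≡g = cong₂ _+_ (f≡g 0 z<s) (∑<ℤ-cong n (λ k → f≡g (suc k) ∘ s≤s))

  ∑<ℤ-zero : ∀ n f → (∀ k → k ℕ.< n → f k ≡ + 0) → ∑<ℤ n f ≡ + 0
  ∑<ℤ-zero zero    f f≡0 = refl
  ∑<ℤ-zero (suc n) f f≡0 = cong₂ _+_ (f≡0 0 z<s) (∑<ℤ-zero n (f ∘ suc) (λ k → f≡0 (suc k) ∘ s≤s))

  ∑<ℤ-suc : ∀ n f → ∑<ℤ (suc n) f ≡ ∑<ℤ n f + f n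
  ∑<ℤ-suc zero    f = trans (+-identityʳ (f 0)) (sym (+-identityˡ (f 0)))
  ∑<ℤ-suc (suc n) f = trans (cong (_+_ (f 0)) (∑<ℤ-suc n (f ∘ suc))) (sym (+-assoc (f 0) _ _))

  ∑<ℤ-+ : ∀ n f g → ∑<ℤ n (λ k → f k + g k) ≡ ∑<ℤ n f + ∑<ℤ n g
  ∑<ℤ-+ zero    f g = refl
  ∑<ℤ-+ (suc n) f g = trans (cong (_+_ (f 0 + g 0)) (∑<ℤ-+ n (f ∘ suc) (g ∘ suc))) (+-interchange (f 0) (g 0) _ _)

  ∑<ℤ-extend : ∀ m n f → m ℕ.≤ n → (∀ k → m ℕ.≤ k → f k ≡ + 0) → ∑<ℤ m f ≡ ∑<ℤ n f
  ∑<ℤ-extend zero    n       f _         f≡0 = sym (∑<ℤ-zero n f (λ k _ → f≡0 k z≤n))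
  ∑<ℤ-extend (suc m) (suc n) f (s≤s m≤n) f≡0 =
    cong (_+_ (f 0)) (∑<ℤ-extend m n (f ∘ suc) m≤n (λ k → f≡0 (suc k) ∘ s≤s))

  ∑ℤ-∑<ℤ : ∀ {A : Set} m (G : A → ℕ → ℤ) xs →
    ∑ℤ (λ x → ∑<ℤ m (G x)) xs ≡ ∑<ℤ m (λ k → ∑ℤ (λ x → G x k) xs)
  ∑ℤ-∑<ℤ m G []       = sym (∑<ℤ-zero m _ (λ _ _ → refl))
  ∑ℤ-∑<ℤ m G (x ∷ xs) = trans (cong (_+_ (∑<ℤ m (G x))) (∑ℤ-∑<ℤ m G xs)) (sym (∑<ℤ-+ m (G x) _))

  ∑ℤ-upTo : ∀ m g → ∑ℤ g (upTo m) ≡ ∑<ℤ m g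
  ∑ℤ-upTo zero    g = refl
  ∑ℤ-upTo (suc m) g = cong (_+_ (g 0)) (begin
    ∑ℤ g (applyUpTo suc m)           ≡⟨ cong (∑ℤ g) (map-upTo suc m) ⟨
    ∑ℤ g (map suc (upTo m))          ≡⟨ ∑ℤ-map g suc (upTo m) ⟩
    ∑ℤ (g ∘ suc) (upTo m)            ≡⟨ ∑ℤ-upTo m (g ∘ suc) ⟩
    ∑<ℤ m (g ∘ suc)                  ∎)
    where open ≡-Reasoning

  coeff-⊕ : ∀ p q j → coeff (p ⊕ q) j ≡ coeff p j + coeff q j
  coeff-⊕ []      q       j       = sym (+-identityˡ _)
  coeff-⊕ (a ∷ p) []      j       = sym (+-identityʳ _)
  coeff-⊕ (a ∷ p) (b ∷ q) zero    = refl
  coeff-⊕ (a ∷ p) (b ∷ q) (suc j) = coeff-⊕ p q j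

  coeff-scale : ∀ c p j → coeff (scale c p) j ≡ c * coeff p j
  coeff-scale c []      j       = sym (*-zeroʳ c)
  coeff-scale c (a ∷ p) zero    = refl
  coeff-scale c (a ∷ p) (suc j) = coeff-scale c p j

  coeff-foldr-⊕ : {A : Set} (P : A → Poly) (xs : List A) (j : ℕ) →
    coeff (foldr (λ x acc → P x ⊕ acc) [] xs) j ≡ ∑ℤ (λ x → coeff (P x) j) xs
  coeff-foldr-⊕ P []       j = refl
  coeff-foldr-⊕ P (x ∷ xs) j = trans (coeff-⊕ (P x) _ j) (cong (_+_ (coeff (P x) j)) (coeff-foldr-⊕ P xs j))

  powCoeff : ℕ → ℕ → ℤ
  powCoeff k j = coeff (pow xMinus1 k) j

  powCoeff-suc-zero : ∀ k → powCoeff (suc k) 0 ≡ - powCoeff k 0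
  powCoeff-suc-zero k = begin
    coeff (scale -[1+ 0 ] q ⊕ (+ 0 ∷ (scale (+ 1) q ⊕ (+ 0 ∷ [])))) 0 ≡⟨ coeff-⊕ (scale -[1+ 0 ] q) _ 0 ⟩
    coeff (scale -[1+ 0 ] q) 0 + + 0                               ≡⟨ +-identityʳ _ ⟩
    coeff (scale -[1+ 0 ] q) 0                                     ≡⟨ coeff-scale -[1+ 0 ] q 0 ⟩
    -[1+ 0 ] * coeff q 0                                           ≡⟨ solve 1 (λ x → con -[1+ 0 ] :* x := :- x) refl (coeff q 0) ⟩
    - coeff q 0                                                    ∎
    where
    open ≡-Reasoning
    q = pow xMinus1 k

  powCoeff-suc-suc : ∀ k j → powCoeff (suc k) (suc j) ≡ powCoeff k j - powCoeff k (suc j)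
  powCoeff-suc-suc k j = begin
    coeff (scale -[1+ 0 ] q ⊕ (+ 0 ∷ (scale (+ 1) q ⊕ (+ 0 ∷ [])))) (suc j)
      ≡⟨ coeff-⊕ (scale -[1+ 0 ] q) _ (suc j) ⟩
    coeff (scale -[1+ 0 ] q) (suc j) + coeff (scale (+ 1) q ⊕ (+ 0 ∷ [])) j
      ≡⟨ cong₂ _+_ (coeff-scale -[1+ 0 ] q (suc j))
                   (trans (coeff-⊕ (scale (+ 1) q) _ j) (cong₂ _+_ (coeff-scale (+ 1) q j) (coeff-zero j))) ⟩
    -[1+ 0 ] * coeff q (suc j) + (+ 1 * coeff q j + + 0)
      ≡⟨ solve 2 (λ x y → con -[1+ 0 ] :* y :+ (con (+ 1) :* x :+ con (+ 0)) := x :- y) refl (coeff q j) (coeff q (suc j)) ⟩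
    coeff q j - coeff q (suc j) ∎
    where
    open ≡-Reasoning
    q = pow xMinus1 k
    coeff-zero : ∀ j → coeff (+ 0 ∷ []) j ≡ + 0
    coeff-zero zero    = refl
    coeff-zero (suc j) = refl

  powCoeff-above : ∀ k j → k ℕ.< j → powCoeff k j ≡ + 0
  powCoeff-above zero    (suc j) _ = refl
  powCoeff-above (suc k) (suc j) (s≤s k<j)
    rewrite powCoeff-suc-suc k j | powCoeff-above k j k<j | powCoeff-above k (suc j) (ℕ.m<n⇒m<1+n k<j) = refl

  powCoeff-diag : ∀ k → powCoeff k k ≡ + 1
  powCoeff-diag zero = refl
  powCoeff-diag (suc k) rewrite powCoeff-suc-suc k k | powCoeff-diag k | powCoeff-above k (suc k) (ℕ.n<1+n k) = refl

  ∑<ℤ-pascal : ∀ f (a : ℕ → ℤ) →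
    ∑<ℤ (2 ℕ.+ f) (λ k → + (suc f C k) * a k) ≡ ∑<ℤ (suc f) (λ k → + (f C k) * (a (suc k) + a k))
  ∑<ℤ-pascal f a = begin
    + 1 * a 0 + ∑<ℤ (suc f) (λ k → + (suc f C suc k) * a (suc k))
      ≡⟨ cong (_+_ (+ 1 * a 0)) (trans (∑<ℤ-cong (suc f) (λ k _ → pascal k)) (∑<ℤ-+ (suc f) X Y')) ⟩
    + 1 * a 0 + (∑<ℤ (suc f) X + ∑<ℤ (suc f) Y')
      ≡⟨ cong (λ z → + 1 * a 0 + (∑<ℤ (suc f) X + z))
              (trans (∑<ℤ-suc f Y') (cong (λ c → ∑<ℤ f Y' + + c * a (suc f)) (k>n⇒nCk≡0 (ℕ.n<1+n f)))) ⟩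
    + 1 * a 0 + (∑<ℤ (suc f) X + (∑<ℤ f Y' + + 0 * a (suc f)))
      ≡⟨ solve 4 (λ a₀ x y t → con (+ 1) :* a₀ :+ (x :+ (y :+ con (+ 0) :* t)) := x :+ (con (+ 1) :* a₀ :+ y))
               refl (a 0) (∑<ℤ (suc f) X) (∑<ℤ f Y') (a (suc f)) ⟩
    ∑<ℤ (suc f) X + ∑<ℤ (suc f) Y
      ≡⟨ ∑<ℤ-+ (suc f) X Y ⟨
    ∑<ℤ (suc f) (λ k → X k + Y k)
      ≡⟨ ∑<ℤ-cong (suc f) (λ k _ → sym (*-distribˡ-+ (+ (f C k)) (a (suc k)) (a k))) ⟩
    ∑<ℤ (suc f) (λ k → + (f C k) * (a (suc k) + a k)) ∎
    where
    open ≡-Reasoning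
    X Y Y' : ℕ → ℤ
    X k  = + (f C k) * a (suc k)
    Y k  = + (f C k) * a k
    Y' k = + (f C suc k) * a (suc k)
    pascal : ∀ k → + (suc f C suc k) * a (suc k) ≡ X k + Y' k
    pascal k = trans (cong (λ c → + c * a (suc k)) (sym (nCk+nC[k+1]≡[n+1]C[k+1] f k)))
                     (*-distribʳ-+ (a (suc k)) (+ (f C k)) (+ (f C suc k)))

  coeff-monomial : ∀ f j → coeff (monomial f) j ≡ ∑<ℤ (suc f) (λ k → + (f C k) * powCoeff k j)
  coeff-monomial zero    j = solve 1 (λ x → x := con (+ 1) :* x :+ con (+ 0)) refl (powCoeff 0 j)
  coeff-monomial (suc f) j = sym (trans (∑<ℤ-pascal f (λ k → powCoeff k j)) (times-x j))
    where
    times-x : ∀ j → ∑<ℤ (suc f) (λ k → + (f C k) * (powCoeff (suc k) j + powCoeff k j)) ≡ coeff (monomial (suc f)) j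
    times-x zero    = ∑<ℤ-zero (suc f) _ (λ k _ →
      trans (cong (λ z → + (f C k) * (z + powCoeff k 0)) (powCoeff-suc-zero k))
            (solve 2 (λ c x → c :* (:- x :+ x) := con (+ 0)) refl (+ (f C k)) (powCoeff k 0)))
    times-x (suc j) = trans (∑<ℤ-cong (suc f) (λ k _ →
      trans (cong (λ z → + (f C k) * (z + powCoeff k (suc j))) (powCoeff-suc-suc k j))
            (solve 3 (λ c x y → c :* ((x :- y) :+ y) := c :* x) refl (+ (f C k)) (powCoeff k j) (powCoeff k (suc j)))))
      (sym (coeff-monomial f j))

  coeff-a : ∀ n j → coeff (a n) j ≡ ∑<ℤ (suc n) (λ k → + fixBinomSum n k * powCoeff k j)
  coeff-a n j = begin
    coeff (a n) j
      ≡⟨ coeff-foldr-⊕ (monomial ∘ fp) (S321 n) j ⟩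
    ∑ℤ (λ π → coeff (monomial (fp π)) j) (S321 n)
      ≡⟨ ∑ℤ-cong (All.map (λ {π} → expand π) (S321-fp≤ n)) ⟩
    ∑ℤ (λ π → ∑<ℤ (suc n) (λ k → + (fp π C k) * powCoeff k j)) (S321 n)
      ≡⟨ ∑ℤ-∑<ℤ (suc n) (λ π k → + (fp π C k) * powCoeff k j) (S321 n) ⟩
    ∑<ℤ (suc n) (λ k → ∑ℤ (λ π → + (fp π C k) * powCoeff k j) (S321 n))
      ≡⟨ ∑<ℤ-cong (suc n) (λ k _ → ∑ℤ-*-pos (λ π → fp π C k) (powCoeff k j) (S321 n)) ⟩
    ∑<ℤ (suc n) (λ k → + fixBinomSum n k * powCoeff k j) ∎
    where
    open ≡-Reasoning
    expand : ∀ π → fp π ℕ.≤ n → coeff (monomial (fp π)) j ≡ ∑<ℤ (suc n) (λ k → + (fp π C k) * powCoeff k j)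
    expand π fp≤n = trans (coeff-monomial (fp π) j)
      (∑<ℤ-extend (suc (fp π)) (suc n) _ (s≤s fp≤n) (λ k fp<k → cong (λ c → + c * powCoeff k j) (k>n⇒nCk≡0 fp<k)))

  coeff-sumShifted : ∀ n β j → coeff (sumShifted n β) j ≡ ∑<ℤ (suc n) (λ k → β k * powCoeff k j)
  coeff-sumShifted n β j = trans (trans (coeff-foldr-⊕ (λ k → scale (β k) (pow xMinus1 k)) (upTo (suc n)) j)
                                        (∑ℤ-cong {xs = upTo (suc n)} (All.tabulate (λ {k} _ → coeff-scale (β k) (pow xMinus1 k) j))))
                                 (∑ℤ-upTo (suc n) (λ k → β k * powCoeff k j))

  ∑<ℤ-powCoeff-last : ∀ n (δ : ℕ → ℤ) → ∑<ℤ (suc n) (λ k → δ k * powCoeff k n) ≡ δ n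
  ∑<ℤ-powCoeff-last n δ = begin
    ∑<ℤ (suc n) (λ k → δ k * powCoeff k n)                ≡⟨ ∑<ℤ-suc n _ ⟩
    ∑<ℤ n (λ k → δ k * powCoeff k n) + δ n * powCoeff n n ≡⟨ cong₂ _+_ (∑<ℤ-zero n _ below) (cong (δ n *_) (powCoeff-diag n)) ⟩
    + 0 + δ n * + 1                                       ≡⟨ trans (+-identityˡ _) (*-identityʳ (δ n)) ⟩
    δ n                                                   ∎
    where
    open ≡-Reasoning
    below : ∀ k → k ℕ.< n → δ k * powCoeff k n ≡ + 0
    below k k<n = trans (cong (δ k *_) (powCoeff-above k n k<n)) (*-zeroʳ (δ k))

  powCoeff-combination-injective : ∀ n (β γ : ℕ → ℤ) →
    (∀ j → ∑<ℤ n (λ k → β k * powCoeff k j) ≡ ∑<ℤ n (λ k → γ k * powCoeff k j)) → ∀ k → k ℕ.< n → β k ≡ γ k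
  powCoeff-combination-injective (suc n) β γ same = equal
    where
    βn≡γn : β n ≡ γ n
    βn≡γn = trans (sym (∑<ℤ-powCoeff-last n β)) (trans (same n) (∑<ℤ-powCoeff-last n γ))
    lower : ∀ j → ∑<ℤ n (λ k → β k * powCoeff k j) ≡ ∑<ℤ n (λ k → γ k * powCoeff k j)
    lower j = ∙-cancelʳ (β n * powCoeff n j) _ _ (begin
      ∑<ℤ n (λ k → β k * powCoeff k j) + β n * powCoeff n j ≡⟨ ∑<ℤ-suc n _ ⟨
      ∑<ℤ (suc n) (λ k → β k * powCoeff k j)                ≡⟨ same j ⟩
      ∑<ℤ (suc n) (λ k → γ k * powCoeff k j)                ≡⟨ ∑<ℤ-suc n _ ⟩
      ∑<ℤ n (λ k → γ k * powCoeff k j) + γ n * powCoeff n j ≡⟨ cong (λ c → ∑<ℤ n (λ k → γ k * powCoeff k j) + c * powCoeff n j)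
                                                                   βn≡γn ⟨
      ∑<ℤ n (λ k → γ k * powCoeff k j) + β n * powCoeff n j ∎)
      where open ≡-Reasoning
    equal : ∀ k → k ℕ.< suc n → β k ≡ γ k
    equal k (s≤s k≤n) with ℕ.m≤n⇒m<n∨m≡n k≤n
    ... | inj₁ k<n  = powCoeff-combination-injective n β γ lower k k<n
    ... | inj₂ refl = βn≡γn

open import Data.Nat using (ℕ; suc)
open import Data.Integer using (ℤ; +_; -[1+_]; _+_; _-_; _<_; _>_)
open import Data.Product using (_×_)
open import Data.Sum using (_⊎_)
open import Relation.Binary.PropositionalEquality using (_≡_; _≢_)

open import Data.Empty using (⊥-elim)
open import Data.Integer using (+<+; -<+)
open import Data.Integer.Properties using (+-identityʳ)
open import Data.Nat as ℕ using (zero; s≤s)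
open import Data.Nat.Properties using (_≤?_; ≰⇒>; +-comm)
open import Data.Product using (_,_)
open import Data.Sum using (inj₁; inj₂)
open import Relation.Binary.PropositionalEquality using (refl; sym; trans; cong; cong₂; module ≡-Reasoning)
open import Relation.Nullary using (yes; no)
open Counting using (fixBinomSum; fixBinomSum-above; fixBinomSum-suc-zero; fixBinomSum-suc-suc)
open Coefficients using (coeff-a; coeff-sumShifted; powCoeff-combination-injective)

b≡fixBinomSum : (b : ℤ → ℤ → ℤ)
  → (∀ x y → (y > x) ⊎ (x < + 0) ⊎ (y < + 0) → b x y ≡ + 0)
  → (∀ (n j : ℕ) → coeff (a n) j ≡ coeff (sumShifted n (λ k → b (+ n) (+ k))) j)
  → ∀ n k → b (+ n) (+ k) ≡ + fixBinomSum n k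
b≡fixBinomSum b vanish expand n k with k ≤? n
... | yes k≤n = sym (powCoeff-combination-injective (suc n) (λ k → + fixBinomSum n k) (λ k → b (+ n) (+ k))
                  (λ j → trans (sym (coeff-a n j)) (trans (expand n j) (coeff-sumShifted n (λ k → b (+ n) (+ k)) j))) k (s≤s k≤n))
... | no k≰n  = trans (vanish (+ n) (+ k) (inj₁ (+<+ (≰⇒> k≰n)))) (cong +_ (sym (fixBinomSum-above n k (≰⇒> k≰n))))

lemma4p2 : (b : ℤ → ℤ → ℤ)
    → (∀ x y → (y > x) ⊎ (x < + 0) ⊎ (y < + 0) → b x y ≡ + 0)
    → (∀ (n j : ℕ) → coeff (a n) j ≡ coeff (sumShifted n (λ k → b (+ n) (+ k))) j)
    → (b (+ 0) (+ 0) ≡ + 1)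
      × (∀ (n : ℕ) (k : ℤ) → k ≢ -[1+ 0 ]
          → b (+ suc n) k ≡ b (+ suc n) (k + + 1) + b (+ n) (k - + 1))
lemma4p2 b vanish expand = b-value 0 0 , recurrence
  where
  open ≡-Reasoning
  b-value : ∀ n k → b (+ n) (+ k) ≡ + fixBinomSum n k
  b-value = b≡fixBinomSum b vanish expand
  recurrence : ∀ (n : ℕ) (k : ℤ) → k ≢ -[1+ 0 ] → b (+ suc n) k ≡ b (+ suc n) (k + + 1) + b (+ n) (k - + 1)
  recurrence n (+ zero) _ = begin
    b (+ suc n) (+ 0)                       ≡⟨ trans (b-value (suc n) 0) (cong +_ (fixBinomSum-suc-zero n)) ⟩
    + fixBinomSum (suc n) 1                 ≡⟨ +-identityʳ _ ⟨
    + fixBinomSum (suc n) 1 + + 0           ≡⟨ cong₂ _+_ (b-value (suc n) 1) (vanish (+ n) _ (inj₂ (inj₂ -<+))) ⟨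
    b (+ suc n) (+ 1) + b (+ n) -[1+ 0 ]    ∎
  recurrence n (+ suc k) _ = begin
    b (+ suc n) (+ suc k)                           ≡⟨ trans (b-value (suc n) (suc k)) (cong +_ (fixBinomSum-suc-suc n k)) ⟩
    + fixBinomSum (suc n) (2 ℕ.+ k) + + fixBinomSum n k ≡⟨ cong₂ _+_ (sym (b-value (suc n) (2 ℕ.+ k))) (sym (b-value n k)) ⟩
    b (+ suc n) (+ (2 ℕ.+ k)) + b (+ n) (+ k)       ≡⟨ cong (λ i → b (+ suc n) (+ i) + b (+ n) (+ k)) (+-comm 1 (suc k)) ⟩
    b (+ suc n) (+ suc k + + 1) + b (+ n) (+ suc k - + 1) ∎
  recurrence n -[1+ zero ]  k≢-1 = ⊥-elim (k≢-1 refl)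
  recurrence n -[1+ suc j ] _ = begin
    b (+ suc n) -[1+ suc j ]                 ≡⟨ vanish _ _ (inj₂ (inj₂ -<+)) ⟩
    + 0                                      ≡⟨ cong₂ _+_ (vanish _ _ (inj₂ (inj₂ -<+))) (vanish _ _ (inj₂ (inj₂ -<+))) ⟨
    b (+ suc n) -[1+ j ] + b (+ n) (-[1+ suc j ] - + 1) ∎
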